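{- If $T$ is a circle-tree, then $3\,|\{x\in T:\delta_T(x)=2\}|>|T|$, and hence $2\,|\{x\in T:\delta_T(x)=2\}|>|\{x\in T:\delta_T(x)=3\}|$.
   Context: All graphs are finite simple graphs; $\delta_T(x)$ is the degree of $x$ in $T$ and $|T|$ the number of vertices. A circle is a finite connected graph in which every vertex has degree exactly $2$. For disjoint graphs $G,H$ with $\Delta(G),\Delta(H)\le3$ and vertices $x\in G$, $y\in H$ of degree $2$ in their respective graphs, $G+_{x,y}H$ is the disjoint union of $G$ and $H$ with the single extra edge $\{x,y\}$. A finite graph $T$ is a circle-tree if there are circles $C(0),\dots,C(k-1)$ ($k\ge1$) and graphs $T(0)=C(0)$, $T(i)=T(i-1)+_{x,y}C(i)$ for $0<i<k$ (with $C(i)$ disjoint from $T(i-1)$, $x\in T(i-1)$ of degree $2$ in $T(i-1)$, $y\in C(i)$), such that $T=T(k-1)$. -}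

module Defs where

open import Data.Nat using (ℕ; zero; suc; _+_; _<_; _≡ᵇ_)
open import Data.Bool using (Bool; true; false; _∧_; if_then_else_)
open import Data.Fin using (Fin; splitAt; _≟_)
open import Data.Sum using (_⊎_; inj₁; inj₂)
open import Data.Product using (_×_)
open import Function.Bundles using (_↔_; Inverse)
open import Relation.Binary.PropositionalEquality using (_≡_)
open import Relation.Nullary.Decidable using (⌊_⌋)

record Graph : Set where
  constructor mkGraph
  field
    n   : ℕ
    adj : Fin n → Fin n → Bool
open Graph public

IsSimple : Graph → Set
IsSimple G = (∀ i j → adj G i j ≡ adj G j i) × (∀ i → adj G i i ≡ false)

countF : ∀ {k} → (Fin k → Bool) → ℕ
countF {zero}  p = 0
countF {suc k} p = (if p Fin.zero then 1 else 0) + countF (λ i → p (Fin.suc i))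

deg : (G : Graph) → Fin (n G) → ℕ
deg G i = countF (adj G i)

numDeg : Graph → ℕ → ℕ
numDeg G d = countF (λ i → deg G i ≡ᵇ d)

data Reach (G : Graph) : Fin (n G) → Fin (n G) → Set where
  here : ∀ {i} → Reach G i i
  step : ∀ {i j k} → adj G i j ≡ true → Reach G j k → Reach G i k

Connected : Graph → Set
Connected G = ∀ i j → Reach G i j

IsCircle : Graph → Set
IsCircle G = IsSimple G × (0 < n G) × Connected G × (∀ i → deg G i ≡ 2)

-- G +_{x,y} H : disjoint union (G on the first n G vertices, H on the rest)
-- plus the single edge {x,y}
joinAt : (G H : Graph) → Fin (n G) → Fin (n H) → Graph
joinAt G H x y = mkGraph (n G + n H) a
  where
  a : Fin (n G + n H) → Fin (n G + n H) → Bool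
  a i j with splitAt (n G) i | splitAt (n G) j
  ... | inj₁ u | inj₁ v = adj G u v
  ... | inj₂ u | inj₂ v = adj H u v
  ... | inj₁ u | inj₂ v = ⌊ u ≟ x ⌋ ∧ ⌊ v ≟ y ⌋
  ... | inj₂ u | inj₁ v = ⌊ u ≟ y ⌋ ∧ ⌊ v ≟ x ⌋

record Iso (G H : Graph) : Set where
  field
    bij  : Fin (n G) ↔ Fin (n H)
    pres : ∀ i j → adj G i j ≡ adj H (Inverse.to bij i) (Inverse.to bij j)

-- circle-trees (closed under isomorphism, i.e. up to renaming vertices)
data CircleTree : Graph → Set where
  base : ∀ {C} → IsCircle C → CircleTree C
  glue : ∀ {T C} → CircleTree T → IsCircle C →
         (x : Fin (n T)) → deg T x ≡ 2 → (y : Fin (n C)) →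
         CircleTree (joinAt T C x y)
  iso  : ∀ {T T'} → CircleTree T → Iso T T' → CircleTree T'

{-# OPTIONS --safe #-}
module Submission where

-- A circle of length m has m vertices of
-- degree 2, and m ≥ 3 because it is loopless.  Gluing a circle of length m
-- onto a degree-2 vertex raises the degrees of the two ends of the new edge
-- from 2 to 3, so it adds m vertices, m − 2 of degree 2 and 2 of degree 3;
-- since 3(m − 2) ≥ m and 2(m − 2) ≥ 2, both strict inequalities survive.
-- Isomorphisms permute the vertices and so preserve every degree count.

open import Defs
open import Data.Nat using (ℕ; zero; suc; _+_; _*_; _≤_; _<_; _>_; _≡ᵇ_; z≤n; s≤s)
open import Data.Nat.Properties
  using (+-comm; +-assoc; +-suc; +-identityʳ; +-monoʳ-≤; +-monoˡ-<; +-cancelʳ-≤;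
         *-distribˡ-+; *-monoʳ-≤; m≤m+n; m<m+n; m≤n⇒m≤1+n; <-≤-trans;
         +-0-commutativeMonoid; module ≤-Reasoning)
open import Data.Product using (_×_; _,_; proj₁; proj₂; map₂)
open import Data.Bool using (Bool; true; false; _∧_; if_then_else_)
open import Data.Fin using (Fin; _↑ˡ_; _↑ʳ_; _≟_; punchIn; fromℕ<)
open import Data.Fin.Properties using (splitAt-↑ˡ; splitAt-↑ʳ; punchInᵢ≢i)
open import Data.Fin.Permutation using (↔⇒≡)
open import Data.Vec.Functional using (removeAt)
open import Function using (_∘_; Inverse; _↔_)
open import Relation.Binary.PropositionalEquality
open import Relation.Nullary.Decidable using (⌊_⌋)
open import Algebra.Properties.CommutativeMonoid.Sum +-0-commutativeMonoid
  using (sum; sum-remove; sum-permute)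

iverson : Bool → ℕ
iverson b = if b then 1 else 0

⌊≟⌋-diag : ∀ {k} (x : Fin k) → ⌊ x ≟ x ⌋ ≡ true
⌊≟⌋-diag x = cong ⌊_⌋ (≡-≟-identity _≟_ refl)

⌊≟⌋-≢ : ∀ {k} {i x : Fin k} → i ≢ x → ⌊ i ≟ x ⌋ ≡ false
⌊≟⌋-≢ i≢x = cong ⌊_⌋ (≢-≟-identity _≟_ i≢x)

countF≡sum : ∀ {k} (p : Fin k → Bool) → countF p ≡ sum (iverson ∘ p)
countF≡sum {zero}  p = refl
countF≡sum {suc k} p = cong (iverson (p Fin.zero) +_) (countF≡sum (p ∘ Fin.suc))

countF-cong : ∀ {k} {p q : Fin k → Bool} → (∀ i → p i ≡ q i) → countF p ≡ countF q
countF-cong {zero}  p≗q = refl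
countF-cong {suc k} p≗q = cong₂ _+_ (cong iverson (p≗q Fin.zero)) (countF-cong (p≗q ∘ Fin.suc))

countF-true : ∀ k → countF {k} (λ _ → true) ≡ k
countF-true zero    = refl
countF-true (suc k) = cong suc (countF-true k)

countF-false : ∀ k → countF {k} (λ _ → false) ≡ 0
countF-false zero    = refl
countF-false (suc k) = countF-false k

countF-≤ : ∀ {k} (p : Fin k → Bool) → countF p ≤ k
countF-≤ {zero}  p = z≤n
countF-≤ {suc k} p with p Fin.zero
... | true  = s≤s (countF-≤ (p ∘ Fin.suc))
... | false = m≤n⇒m≤1+n (countF-≤ (p ∘ Fin.suc))

countF-++ : ∀ a {c} (p : Fin (a + c) → Bool) →
            countF p ≡ countF (λ i → p (i ↑ˡ c)) + countF (λ j → p (a ↑ʳ j))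
countF-++ zero    p = refl
countF-++ (suc a) p = trans (cong (iverson (p Fin.zero) +_) (countF-++ a (p ∘ Fin.suc)))
                             (sym (+-assoc (iverson (p Fin.zero)) _ _))

countF-permute : ∀ {m k} (p : Fin k → Bool) (π : Fin m ↔ Fin k) →
                 countF p ≡ countF (p ∘ Inverse.to π)
countF-permute p π = begin
  countF p                         ≡⟨ countF≡sum p ⟩
  sum (iverson ∘ p)                ≡⟨ sum-permute (iverson ∘ p) π ⟩
  sum (iverson ∘ p ∘ Inverse.to π) ≡⟨ countF≡sum (p ∘ Inverse.to π) ⟨
  countF (p ∘ Inverse.to π)        ∎
  where open ≡-Reasoning

countF-removeAt : ∀ {k} (p : Fin (suc k) → Bool) (x : Fin (suc k)) →
                  countF p ≡ iverson (p x) + countF (removeAt p x)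
countF-removeAt p x = begin
  countF p                                     ≡⟨ countF≡sum p ⟩
  sum (iverson ∘ p)                            ≡⟨ sum-remove (iverson ∘ p) ⟩
  iverson (p x) + sum (iverson ∘ removeAt p x) ≡⟨ cong (_ +_) (countF≡sum (removeAt p x)) ⟨
  iverson (p x) + countF (removeAt p x)        ∎
  where open ≡-Reasoning

countF-< : ∀ {k} (p : Fin k → Bool) (x : Fin k) → p x ≡ false → countF p < k
countF-< {suc k} p x px≡false = s≤s (begin
  countF p                              ≡⟨ countF-removeAt p x ⟩
  iverson (p x) + countF (removeAt p x) ≡⟨ cong (λ b → iverson b + countF (removeAt p x)) px≡false ⟩
  countF (removeAt p x)                 ≤⟨ countF-≤ (removeAt p x) ⟩
  k                                     ∎)
  where open ≤-Reasoning

countF-update : ∀ {k} (p q : Fin k → Bool) (x : Fin k) → (∀ i → i ≢ x → p i ≡ q i) →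
                countF p + iverson (q x) ≡ countF q + iverson (p x)
countF-update {suc k} p q x p≡q = begin
  countF p + iverson (q x)                              ≡⟨ cong (_+ iverson (q x)) (countF-removeAt p x) ⟩
  iverson (p x) + countF (removeAt p x) + iverson (q x) ≡⟨ cong (λ r → iverson (p x) + r + iverson (q x)) rest ⟩
  iverson (p x) + countF (removeAt q x) + iverson (q x) ≡⟨ swap (iverson (p x)) _ (iverson (q x)) ⟩
  iverson (q x) + countF (removeAt q x) + iverson (p x) ≡⟨ cong (_+ iverson (p x)) (countF-removeAt q x) ⟨
  countF q + iverson (p x)                              ∎
  where
  open ≡-Reasoning
  rest : countF (removeAt p x) ≡ countF (removeAt q x)
  rest = countF-cong (λ j → p≡q (punchIn x j) (punchInᵢ≢i x j))
  swap : ∀ a r c → a + r + c ≡ c + r + a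
  swap a r c = trans (+-assoc a r c) (trans (+-comm a (r + c)) (cong (_+ a) (+-comm r c)))

countF-≟ : ∀ {k} (x : Fin k) → countF (λ i → ⌊ i ≟ x ⌋) ≡ 1
countF-≟ {k} x = begin
  countF (λ i → ⌊ i ≟ x ⌋)                     ≡⟨ +-identityʳ _ ⟨
  countF (λ i → ⌊ i ≟ x ⌋) + 0                 ≡⟨ countF-update _ (λ _ → false) x (λ _ → ⌊≟⌋-≢) ⟩
  countF {k} (λ _ → false) + iverson ⌊ x ≟ x ⌋
    ≡⟨ cong₂ (λ c b → c + iverson b) (countF-false k) (⌊≟⌋-diag x) ⟩
  1                                            ∎
  where open ≡-Reasoning

countF-∧-≟ : ∀ {k} (b : Bool) (x : Fin k) → countF (λ i → b ∧ ⌊ i ≟ x ⌋) ≡ iverson b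
countF-∧-≟     true  x = countF-≟ x
countF-∧-≟ {k} false x = countF-false k

fiberSize : ∀ {k} → (Fin k → ℕ) → ℕ → ℕ
fiberSize f d = countF (λ i → f i ≡ᵇ d)

bump : ∀ {k} → (Fin k → ℕ) → Fin k → Fin k → ℕ
bump f x i = f i + iverson ⌊ i ≟ x ⌋

fiberSize-bump : ∀ {k} (f : Fin k → ℕ) (x : Fin k) (d : ℕ) →
                 fiberSize (bump f x) d + iverson (f x ≡ᵇ d) ≡
                 fiberSize f d + iverson (suc (f x) ≡ᵇ d)
fiberSize-bump f x d = begin
  fiberSize (bump f x) d + iverson (f x ≡ᵇ d) ≡⟨ countF-update _ _ x off-x ⟩
  fiberSize f d + iverson (bump f x x ≡ᵇ d)
    ≡⟨ cong (λ b → fiberSize f d + iverson ((f x + iverson b) ≡ᵇ d)) (⌊≟⌋-diag x) ⟩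
  fiberSize f d + iverson ((f x + 1) ≡ᵇ d)
    ≡⟨ cong (λ m → fiberSize f d + iverson (m ≡ᵇ d)) (+-comm (f x) 1) ⟩
  fiberSize f d + iverson (suc (f x) ≡ᵇ d)    ∎
  where
  open ≡-Reasoning
  off-x : ∀ i → i ≢ x → (bump f x i ≡ᵇ d) ≡ (f i ≡ᵇ d)
  off-x i i≢x = cong (_≡ᵇ d) (trans (cong (λ b → f i + iverson b) (⌊≟⌋-≢ i≢x)) (+-identityʳ (f i)))

fiberSize-bump-2 : ∀ {k} (f : Fin k → ℕ) (x : Fin k) → f x ≡ 2 →
                   fiberSize (bump f x) 2 + 1 ≡ fiberSize f 2
fiberSize-bump-2 f x fx≡2 with fiberSize-bump f x 2
... | bumped rewrite fx≡2 = trans bumped (+-identityʳ (fiberSize f 2))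

fiberSize-bump-3 : ∀ {k} (f : Fin k → ℕ) (x : Fin k) → f x ≡ 2 →
                   fiberSize (bump f x) 3 ≡ fiberSize f 3 + 1
fiberSize-bump-3 f x fx≡2 with fiberSize-bump f x 3
... | bumped rewrite fx≡2 = trans (sym (+-identityʳ (fiberSize (bump f x) 3))) bumped

module _ (T C : Graph) (x : Fin (n T)) (y : Fin (n C)) where

  private
    G : Graph
    G = joinAt T C x y

  adj-joinAt-↑ˡ-↑ˡ : ∀ u v → adj G (u ↑ˡ n C) (v ↑ˡ n C) ≡ adj T u v
  adj-joinAt-↑ˡ-↑ˡ u v rewrite splitAt-↑ˡ (n T) u (n C) | splitAt-↑ˡ (n T) v (n C) = refl

  adj-joinAt-↑ˡ-↑ʳ : ∀ u w → adj G (u ↑ˡ n C) (n T ↑ʳ w) ≡ ⌊ u ≟ x ⌋ ∧ ⌊ w ≟ y ⌋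
  adj-joinAt-↑ˡ-↑ʳ u w rewrite splitAt-↑ˡ (n T) u (n C) | splitAt-↑ʳ (n T) (n C) w = refl

  adj-joinAt-↑ʳ-↑ˡ : ∀ w u → adj G (n T ↑ʳ w) (u ↑ˡ n C) ≡ ⌊ w ≟ y ⌋ ∧ ⌊ u ≟ x ⌋
  adj-joinAt-↑ʳ-↑ˡ w u rewrite splitAt-↑ʳ (n T) (n C) w | splitAt-↑ˡ (n T) u (n C) = refl

  adj-joinAt-↑ʳ-↑ʳ : ∀ w z → adj G (n T ↑ʳ w) (n T ↑ʳ z) ≡ adj C w z
  adj-joinAt-↑ʳ-↑ʳ w z rewrite splitAt-↑ʳ (n T) (n C) w | splitAt-↑ʳ (n T) (n C) z = refl

  deg-joinAt-↑ˡ : ∀ u → deg G (u ↑ˡ n C) ≡ bump (deg T) x u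
  deg-joinAt-↑ˡ u = trans (countF-++ (n T) (adj G (u ↑ˡ n C)))
    (cong₂ _+_ (countF-cong (adj-joinAt-↑ˡ-↑ˡ u))
               (trans (countF-cong (adj-joinAt-↑ˡ-↑ʳ u)) (countF-∧-≟ ⌊ u ≟ x ⌋ y)))

  deg-joinAt-↑ʳ : ∀ w → deg G (n T ↑ʳ w) ≡ bump (deg C) y w
  deg-joinAt-↑ʳ w = trans (countF-++ (n T) (adj G (n T ↑ʳ w)))
    (trans (cong₂ _+_ (trans (countF-cong (adj-joinAt-↑ʳ-↑ˡ w)) (countF-∧-≟ ⌊ w ≟ y ⌋ x))
                      (countF-cong (adj-joinAt-↑ʳ-↑ʳ w)))
           (+-comm (iverson ⌊ w ≟ y ⌋) (deg C w)))

  numDeg-joinAt : ∀ d → numDeg G d ≡ fiberSize (bump (deg T) x) d + fiberSize (bump (deg C) y) d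
  numDeg-joinAt d = trans (countF-++ (n T) (λ i → deg G i ≡ᵇ d))
    (cong₂ _+_ (countF-cong (cong (_≡ᵇ d) ∘ deg-joinAt-↑ˡ))
               (countF-cong (cong (_≡ᵇ d) ∘ deg-joinAt-↑ʳ)))

module _ {C : Graph} (circle : IsCircle C) where

  private
    deg≡2 : ∀ i → deg C i ≡ 2
    deg≡2 = proj₂ (proj₂ (proj₂ circle))

  circle-size : 3 ≤ n C
  circle-size = subst (_< n C) (deg≡2 v) (countF-< (adj C v) v (proj₂ (proj₁ circle) v))
    where
    v : Fin (n C)
    v = fromℕ< (proj₁ (proj₂ circle))

  circle-numDeg-2 : numDeg C 2 ≡ n C
  circle-numDeg-2 = trans (countF-cong (cong (_≡ᵇ 2) ∘ deg≡2)) (countF-true (n C))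

  circle-numDeg-3 : numDeg C 3 ≡ 0
  circle-numDeg-3 = trans (countF-cong (cong (_≡ᵇ 3) ∘ deg≡2)) (countF-false (n C))

  module _ {T : Graph} (x : Fin (n T)) (degx≡2 : deg T x ≡ 2) (y : Fin (n C)) where

    numDeg-glue-2 : numDeg (joinAt T C x y) 2 + 2 ≡ numDeg T 2 + n C
    numDeg-glue-2 = begin
      numDeg (joinAt T C x y) 2 + 2 ≡⟨ cong (_+ 2) (numDeg-joinAt T C x y 2) ⟩
      A + B + 2                     ≡⟨ regroup ⟩
      (A + 1) + (B + 1)
        ≡⟨ cong₂ _+_ (fiberSize-bump-2 (deg T) x degx≡2) (fiberSize-bump-2 (deg C) y (deg≡2 y)) ⟩
      numDeg T 2 + numDeg C 2       ≡⟨ cong (numDeg T 2 +_) circle-numDeg-2 ⟩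
      numDeg T 2 + n C              ∎
      where
      open ≡-Reasoning
      A B : ℕ
      A = fiberSize (bump (deg T) x) 2
      B = fiberSize (bump (deg C) y) 2
      regroup : A + B + 2 ≡ (A + 1) + (B + 1)
      regroup = trans (+-assoc A B 2) (trans (cong (A +_) (+-suc B 1)) (sym (+-assoc A 1 (B + 1))))

    numDeg-glue-3 : numDeg (joinAt T C x y) 3 ≡ numDeg T 3 + 2
    numDeg-glue-3 = begin
      numDeg (joinAt T C x y) 3           ≡⟨ numDeg-joinAt T C x y 3 ⟩
      fiberSize (bump (deg T) x) 3 + fiberSize (bump (deg C) y) 3
        ≡⟨ cong₂ _+_ (fiberSize-bump-3 (deg T) x degx≡2) (fiberSize-bump-3 (deg C) y (deg≡2 y)) ⟩
      (numDeg T 3 + 1) + (numDeg C 3 + 1) ≡⟨ cong (λ m → numDeg T 3 + 1 + (m + 1)) circle-numDeg-3 ⟩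
      (numDeg T 3 + 1) + 1                ≡⟨ +-assoc (numDeg T 3) 1 1 ⟩
      numDeg T 3 + 2                      ∎
      where open ≡-Reasoning

Degree2Dominant : Graph → Set
Degree2Dominant T = (3 * numDeg T 2 > n T) × (2 * numDeg T 2 > numDeg T 3)

circle-degree2Dominant : ∀ {C} → IsCircle C → Degree2Dominant C
circle-degree2Dominant {C} circle
  rewrite circle-numDeg-2 circle | circle-numDeg-3 circle = m<3m , <-≤-trans 0<m (m≤m+n m (m + 0))
  where
  m : ℕ
  m = n C
  0<m : 0 < m
  0<m = proj₁ (proj₂ circle)
  m<3m : m < 3 * m
  m<3m = <-≤-trans (m<m+n m 0<m) (+-monoʳ-≤ m (m≤m+n m (m + 0)))

dominance-step : ∀ {a a′ m t s} → 3 ≤ m → a′ + 2 ≡ a + m →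
                 3 * a > t → 2 * a > s → (3 * a′ > t + m) × (2 * a′ > s + 2)
dominance-step {a} {a′} {m} {t} {s} 3≤m a′+2≡a+m t<3a s<2a =
  <-≤-trans (+-monoˡ-< m t<3a) 3a+m≤3a′ , <-≤-trans (+-monoˡ-< 2 s<2a) 2a+2≤2a′
  where
  open ≤-Reasoning
  scale : ∀ k → k * a + k * m ≡ k * a′ + k * 2
  scale k = trans (sym (*-distribˡ-+ k a m))
                  (trans (cong (k *_) (sym a′+2≡a+m)) (*-distribˡ-+ k a′ 2))
  6≤2m : 6 ≤ 2 * m
  6≤2m = *-monoʳ-≤ 2 3≤m
  3a+m≤3a′ : 3 * a + m ≤ 3 * a′
  3a+m≤3a′ = +-cancelʳ-≤ 6 _ _ (begin
    3 * a + m + 6   ≡⟨ +-assoc (3 * a) m 6 ⟩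
    3 * a + (m + 6) ≤⟨ +-monoʳ-≤ (3 * a) (+-monoʳ-≤ m 6≤2m) ⟩
    3 * a + 3 * m   ≡⟨ scale 3 ⟩
    3 * a′ + 6      ∎)
  2a+2≤2a′ : 2 * a + 2 ≤ 2 * a′
  2a+2≤2a′ = +-cancelʳ-≤ 4 _ _ (begin
    2 * a + 2 + 4   ≡⟨ +-assoc (2 * a) 2 4 ⟩
    2 * a + 6       ≤⟨ +-monoʳ-≤ (2 * a) 6≤2m ⟩
    2 * a + 2 * m   ≡⟨ scale 2 ⟩
    2 * a′ + 4      ∎)

glue-degree2Dominant : ∀ {T C} → IsCircle C → (x : Fin (n T)) → deg T x ≡ 2 → (y : Fin (n C)) →
                       Degree2Dominant T → Degree2Dominant (joinAt T C x y)
glue-degree2Dominant {T} {C} circle x degx≡2 y (t<3a , s<2a) =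
  map₂ (subst (2 * numDeg (joinAt T C x y) 2 >_) (sym (numDeg-glue-3 circle x degx≡2 y)))
       (dominance-step (circle-size circle) (numDeg-glue-2 circle x degx≡2 y) t<3a s<2a)

module _ {T T′ : Graph} (I : Iso T T′) where

  private
    to : Fin (n T) → Fin (n T′)
    to = Inverse.to (Iso.bij I)

  deg-iso : ∀ i → deg T′ (to i) ≡ deg T i
  deg-iso i = trans (countF-permute (adj T′ (to i)) (Iso.bij I)) (countF-cong (sym ∘ Iso.pres I i))

  numDeg-iso : ∀ d → numDeg T′ d ≡ numDeg T d
  numDeg-iso d = trans (countF-permute _ (Iso.bij I)) (countF-cong (cong (_≡ᵇ d) ∘ deg-iso))

  iso-degree2Dominant : Degree2Dominant T → Degree2Dominant T′
  iso-degree2Dominant dominant rewrite numDeg-iso 2 | numDeg-iso 3 | sym (↔⇒≡ (Iso.bij I)) = dominant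

lemma4p14 : (T : Graph) → CircleTree T →
    (3 * numDeg T 2 > n T) × (2 * numDeg T 2 > numDeg T 3)
lemma4p14 T (base circle)                 = circle-degree2Dominant circle
lemma4p14 _ (glue tree circle x degx≡2 y) = glue-degree2Dominant circle x degx≡2 y (lemma4p14 _ tree)
lemma4p14 _ (iso tree I)                  = iso-degree2Dominant I (lemma4p14 _ tree)
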